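{- Let $a_0,\ldots,a_n\in\mathbb{N}_0$, let $c_1,\ldots,c_k$ be integers, and assume there exist polynomials $P_1(X),\ldots,P_k(X)\in\mathbb{Z}[X]$ such that $$P_1(X)\approx\ldots\approx P_k(X)\approx\sum_{i=0}^n a_iX^i\quad\text{and}\quad c_1P_1(X)+\ldots+c_kP_k(X)=0.$$ Then for every idempotent ultrafilter $\mathcal{U}$ and every $A\in a_0\,\mathcal{U}\oplus\ldots\oplus a_n\,\mathcal{U}$ there exist $x_1,\ldots,x_k\in A$ with $c_1x_1+\ldots+c_kx_k=0$. Moreover, if the polynomials $P_1,\ldots,P_k$ are pairwise distinct, then $x_1,\ldots,x_k$ can be chosen pairwise distinct.
   Context: $\mathbb{N}$ denotes the positive integers and $\mathbb{N}_0=\mathbb{N}\cup\{0\}$. All ultrafilters are on $\mathbb{N}_0$. The pseudo-sum is defined by $A\in\mathcal{U}\oplus\mathcal{V}$ iff $\{n\in\mathbb{N}_0: A-n\in\mathcal{V}\}\in\mathcal{U}$, where $A-n=\{m\in\mathbb{N}_0: m+n\in A\}$; it is associative. For $h\in\mathbb{N}_0$, $A\in h\,\mathcal{U}$ iff $\{n: nh\in A\}\in\mathcal{U}$. An idempotent ultrafilter is a non-principal $\mathcal{U}$ with $\mathcal{U}\oplus\mathcal{U}=\mathcal{U}$. The $u$-equivalence $\approx$ on finite strings of integers is the smallest equivalence relation such that: the empty string is equivalent to $\langle 0\rangle$; $\langle a\rangle\approx\langle a,a\rangle$ for every integer $a$; and if $\sigma\approx\sigma'$ and $\tau\approx\tau'$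 then the concatenations satisfy $\sigma^\frown\tau\approx\sigma'^\frown\tau'$. Two polynomials $\sum_{i=0}^n a_iX^i$ and $\sum_{j=0}^m b_jX^j$ in $\mathbb{Z}[X]$ are $u$-equivalent ($\approx$) if their coefficient strings $\langle a_0,\ldots,a_n\rangle$ and $\langle b_0,\ldots,b_m\rangle$ are $u$-equivalent. -}

module Defs where

open import Data.Nat using (ℕ; zero; suc) renaming (_+_ to _+ℕ_; _*_ to _*ℕ_)
open import Data.Integer using (ℤ; +_; 0ℤ; _+_; _*_)
open import Data.Fin using (Fin; zero; suc)
open import Data.List using (List; []; _∷_; _++_; map)
open import Data.Product using (Σ; ∃; _×_; _,_)
open import Data.Sum using (_⊎_)
open import Data.Unit using (⊤)
open import Relation.Nullary using (¬_)
open import Relation.Binary.PropositionalEquality using (_≡_; _≢_)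

Subset : Set₁
Subset = ℕ → Set

SetSystem : Set₁
SetSystem = Subset → Set

record IsUltrafilter (U : SetSystem) : Set₁ where
  field
    full      : U (λ _ → ⊤)
    -- properness (∅ ∉ U), in its constructive form: members are inhabited
    inhabited : ∀ {A} → U A → ∃ λ n → A n
    upward    : ∀ {A B : Subset} → (∀ n → A n → B n) → U A → U B
    inter     : ∀ {A B : Subset} → U A → U B → U (λ n → A n × B n)
    ultra     : ∀ (A : Subset) → U A ⊎ U (λ n → ¬ A n)

NonPrincipal : SetSystem → Set
NonPrincipal U = ∀ n → ¬ U (λ m → m ≡ n)

shift : Subset → ℕ → Subset
shift A n m = A (m +ℕ n)

_⊕_ : SetSystem → SetSystem → SetSystem
(U ⊕ V) A = U (λ n → V (shift A n))

_·_ : ℕ → SetSystem → SetSystem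
(h · U) A = U (λ n → A (n *ℕ h))

IsIdempotent : SetSystem → Set₁
IsIdempotent U = IsUltrafilter U × NonPrincipal U ×
                 (∀ A → ((U ⊕ U) A → U A) × (U A → (U ⊕ U) A))

-- a₀ U ⊕ a₁ U ⊕ … ⊕ aₙ U  for the coefficient string ⟨a₀, …, aₙ⟩ = a₀ ∷ as
-- (bracketed to the right; ⊕ is associative)
linComb : ℕ → List ℕ → SetSystem → SetSystem
linComb a []       U = a · U
linComb a (b ∷ bs) U = (a · U) ⊕ linComb b bs U

data _≈u_ : List ℤ → List ℤ → Set where
  empty≈zero : [] ≈u (0ℤ ∷ [])
  dup        : ∀ a → (a ∷ []) ≈u (a ∷ a ∷ [])
  ≈u-refl    : ∀ {σ} → σ ≈u σ
  ≈u-sym     : ∀ {σ τ} → σ ≈u τ → τ ≈u σ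
  ≈u-trans   : ∀ {σ τ ρ} → σ ≈u τ → τ ≈u ρ → σ ≈u ρ
  ≈u-++      : ∀ {σ σ' τ τ'} → σ ≈u σ' → τ ≈u τ' → (σ ++ τ) ≈u (σ' ++ τ')

-- Polynomials in ℤ[X] as coefficient strings ⟨a₀, …, aₙ⟩.

coeff : List ℤ → ℕ → ℤ
coeff []       _       = 0ℤ
coeff (a ∷ _)  zero    = a
coeff (_ ∷ as) (suc i) = coeff as i

-- equality of polynomials (coefficientwise; insensitive to trailing zeros)
_≡Poly_ : List ℤ → List ℤ → Set
P ≡Poly Q = ∀ i → coeff P i ≡ coeff Q i

sumFin : ∀ {k} → (Fin k → ℤ) → ℤ
sumFin {zero}  f = 0ℤ
sumFin {suc k} f = f zero + sumFin (λ j → f (suc j))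

LinRelZero : ∀ {k} → (Fin k → ℤ) → (Fin k → List ℤ) → Set
LinRelZero c P = ∀ i → sumFin (λ j → c j * coeff (P j) i) ≡ 0ℤ

natPoly : ℕ → List ℕ → List ℤ
natPoly a as = map +_ (a ∷ as)

module Submission where

-- Write ⟦ σ ⟧ for the iterated pseudo-sum σ₀U ⊕ … ⊕ σₙU. Idempotence of U gives
-- ⟦ ⟨a⟩ ⟧ = ⟦ ⟨a,a⟩ ⟧, so ⟦ σ ⟧ only depends on the u-equivalence class of σ, and
-- A ∈ ⟦ Pⱼ ⟧ for every j. Unfolding the pseudo-sums one summand at a time, a single
-- sequence y₀, y₁, … of witnesses serves all j at once, giving xⱼ = Σᵢ coeffᵢ(Pⱼ) yᵢ ∈ A,
-- and Σ cⱼ Pⱼ = 0 turns into Σ cⱼ xⱼ = 0. Since U is non-principal each yᵢ can be taken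
-- larger than all contributions of y₀, …, yᵢ₋₁, which makes xᵢ and xⱼ differ as soon as
-- Pᵢ and Pⱼ do.

open import Defs
open import Data.Nat using (ℕ; zero; suc; _+_; _≤_; _⊔_; _≟_; z≤n; s≤s) renaming (_*_ to _*ℕ_)
open import Data.Nat.Properties
  using (≤-trans; m≤m+n; m≤m⊔n; m≤n⊔m; +-monoˡ-≤; +-monoʳ-≤; *-monoʳ-≤;
         +-assoc; +-comm; +-identityʳ; *-suc; *-zeroʳ; *-distribʳ-+; <-cmp; m+1+n≰m; ≤∧≢⇒<;
         module ≤-Reasoning)
open import Data.Integer using (ℤ; +_; 0ℤ; _*_; ∣_∣; +≤+) renaming (_+_ to _+ℤ_; _≤_ to _≤ℤ_)
open import Data.Integer.Properties using (pos-+; pos-*; 0≤i⇒+∣i∣≡i) renaming (*-zeroʳ to *ℤ-zeroʳ; +-identityˡ to +ℤ-identityˡ)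
open import Data.Integer.Solver using (module +-*-Solver)
open import Data.Fin using (Fin; zero; suc)
open import Data.List using (List; []; _∷_; _++_; map; length)
open import Data.List.Properties using (map-++)
open import Data.List.Relation.Unary.All using (All; []; _∷_; universal)
open import Data.List.Relation.Unary.All.Properties using (map⁺; ++⁺; ++⁻ˡ; ++⁻ʳ)
open import Data.Product using (∃; _×_; _,_; proj₁; proj₂)
open import Data.Sum using (_⊎_; inj₁; inj₂)
open import Data.Empty using (⊥-elim)
open import Function using (_∘_)
open import Function.Bundles using (_⇔_; mk⇔; Equivalence)
open import Function.Properties.Equivalence using () renaming (refl to ⇔-refl; sym to ⇔-sym; trans to ⇔-trans)
open import Relation.Nullary using (¬_; yes; no)
open import Relation.Binary.Definitions using (tri<; tri≈; tri>)
open import Relation.Binary.PropositionalEquality using (_≡_; _≢_; refl; sym; trans; cong; cong₂; subst; module ≡-Reasoning)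

open Equivalence using (to; from)

head₀ : List ℕ → ℕ
head₀ []      = 0
head₀ (s ∷ _) = s

tail₀ : List ℕ → List ℕ
tail₀ []      = []
tail₀ (_ ∷ σ) = σ

coeffℕ : List ℕ → ℕ → ℕ
coeffℕ σ zero    = head₀ σ
coeffℕ σ (suc i) = coeffℕ (tail₀ σ) i

infix 4 _≈ᶜ_

_≈ᶜ_ : List ℕ → List ℕ → Set
σ ≈ᶜ τ = ∀ i → coeffℕ σ i ≡ coeffℕ τ i

≈ᶜ-∷ : ∀ {σ τ} → head₀ σ ≡ head₀ τ → tail₀ σ ≈ᶜ tail₀ τ → σ ≈ᶜ τ
≈ᶜ-∷ heads _     zero    = heads
≈ᶜ-∷ _     tails (suc i) = tails i

≈ᶜ-[] : ∀ σ τ → length σ ≤ 0 → length τ ≤ 0 → σ ≈ᶜ τ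
≈ᶜ-[] [] [] _ _ _ = refl

length-tail₀ : ∀ σ {D} → length σ ≤ suc D → length (tail₀ σ) ≤ D
length-tail₀ []      _         = z≤n
length-tail₀ (_ ∷ _) (s≤s len) = len

dot : List ℕ → List ℕ → ℕ
dot σ []       = 0
dot σ (y ∷ ys) = dot (tail₀ σ) ys + y *ℕ head₀ σ

dot-resp-≈ᶜ : ∀ {σ τ} → σ ≈ᶜ τ → ∀ ys → dot σ ys ≡ dot τ ys
dot-resp-≈ᶜ σ≈τ []       = refl
dot-resp-≈ᶜ σ≈τ (y ∷ ys) = cong₂ _+_ (dot-resp-≈ᶜ (σ≈τ ∘ suc) ys) (cong (y *ℕ_) (σ≈τ 0))

maxFin : ∀ {k} → (Fin k → ℕ) → ℕ
maxFin {zero}  f = 0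
maxFin {suc k} f = f zero ⊔ maxFin (f ∘ suc)

≤-maxFin : ∀ {k} (f : Fin k → ℕ) j → f j ≤ maxFin f
≤-maxFin f zero    = m≤m⊔n (f zero) _
≤-maxFin f (suc j) = ≤-trans (≤-maxFin (f ∘ suc) j) (m≤n⊔m (f zero) _)

Apart : ℕ → ℕ → ℕ → Set
Apart N x y = x + N ≤ y ⊎ y + N ≤ x

apart⇒≢ : ∀ {N x y} → Apart (suc N) x y → x ≢ y
apart⇒≢ {x = x} (inj₁ le) refl = m+1+n≰m x le
apart⇒≢ {x = x} (inj₂ le) refl = m+1+n≰m x le

≤-+-slack : ∀ {N K t p} s q → s + (N + K) ≤ t → p ≤ K → s + p + N ≤ t + q
≤-+-slack {N} {K} {t} {p} s q le p≤K = begin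
  s + p + N   ≤⟨ +-monoˡ-≤ N (+-monoʳ-≤ s p≤K) ⟩
  s + K + N   ≡⟨ trans (+-assoc s K N) (cong (_+_ s) (+-comm K N)) ⟩
  s + (N + K) ≤⟨ le ⟩
  t           ≤⟨ m≤m+n t q ⟩
  t + q       ∎
  where open ≤-Reasoning

apart-+ : ∀ {N K s t p q} → Apart (N + K) s t → p ≤ K → q ≤ K → Apart N (s + p) (t + q)
apart-+ {s = s} {t} {p} {q} (inj₁ le) p≤K _   = inj₁ (≤-+-slack s q le p≤K)
apart-+ {s = s} {t} {p} {q} (inj₂ le) _   q≤K = inj₂ (≤-+-slack t p le q≤K)

≤-+-scaled : ∀ {N y h h'} T → N ≤ y → suc h ≤ h' → T + y *ℕ h + N ≤ T + y *ℕ h'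
≤-+-scaled {N} {y} {h} {h'} T N≤y h<h' = begin
  T + y *ℕ h + N ≤⟨ +-monoʳ-≤ (T + y *ℕ h) N≤y ⟩
  T + y *ℕ h + y ≡⟨ trans (+-assoc T _ y) (cong (_+_ T) (trans (+-comm _ y) (sym (*-suc y h)))) ⟩
  T + y *ℕ suc h ≤⟨ +-monoʳ-≤ T (*-monoʳ-≤ y h<h') ⟩
  T + y *ℕ h'    ∎
  where open ≤-Reasoning

apart-scaled : ∀ {N y h h'} T → N ≤ y → h ≢ h' → Apart N (T + y *ℕ h) (T + y *ℕ h')
apart-scaled {h = h} {h'} T N≤y h≢h' with <-cmp h h'
... | tri< h<h' _ _ = inj₁ (≤-+-scaled T N≤y h<h')
... | tri≈ _ h≡h' _ = ⊥-elim (h≢h' h≡h')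
... | tri> _ _ h>h' = inj₂ (≤-+-scaled T N≤y h>h')

Separated : ∀ {k} → ℕ → (Fin k → List ℕ) → List ℕ → Set
Separated N b ys = ∀ i j → b i ≈ᶜ b j ⊎ Apart N (dot (b i) ys) (dot (b j) ys)

-- The slack y * M in the hypothesis absorbs the new summands y * head₀ when the tails
-- are already apart; otherwise the tails have equal values and the heads decide.
separated-∷ : ∀ {N M} σ τ y ys → N ≤ y → head₀ σ ≤ M → head₀ τ ≤ M →
              tail₀ σ ≈ᶜ tail₀ τ ⊎ Apart (N + y *ℕ M) (dot (tail₀ σ) ys) (dot (tail₀ τ) ys) →
              σ ≈ᶜ τ ⊎ Apart N (dot σ (y ∷ ys)) (dot τ (y ∷ ys))
separated-∷ σ τ y ys _ σ≤M τ≤M (inj₂ tails-apart) =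
  inj₂ (apart-+ tails-apart (*-monoʳ-≤ y σ≤M) (*-monoʳ-≤ y τ≤M))
separated-∷ {N} σ τ y ys N≤y _ _ (inj₁ tails≈) with head₀ σ ≟ head₀ τ
... | yes heads≡ = inj₁ (≈ᶜ-∷ heads≡ tails≈)
... | no  heads≢ = inj₂ (subst (λ T → Apart N (dot (tail₀ σ) ys + y *ℕ head₀ σ) (T + y *ℕ head₀ τ))
                               (dot-resp-≈ᶜ tails≈ ys)
                               (apart-scaled (dot (tail₀ σ) ys) N≤y heads≢))

sumFin-cong : ∀ {k} {f g : Fin k → ℤ} → (∀ j → f j ≡ g j) → sumFin f ≡ sumFin g
sumFin-cong {zero}  f≡g = refl
sumFin-cong {suc k} f≡g = cong₂ _+ℤ_ (f≡g zero) (sumFin-cong (f≡g ∘ suc))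

weightedSum : ∀ {k} → (Fin k → ℤ) → (Fin k → ℕ) → ℤ
weightedSum c x = sumFin (λ j → c j * + x j)

weightedSum-0 : ∀ {k} (c : Fin k → ℤ) → weightedSum c (λ _ → 0) ≡ 0ℤ
weightedSum-0 {zero}  c = refl
weightedSum-0 {suc k} c = cong₂ _+ℤ_ (*ℤ-zeroʳ (c zero)) (weightedSum-0 (c ∘ suc))

weightedSum-+* : ∀ {k} (c : Fin k → ℤ) (f g : Fin k → ℕ) y →
                 weightedSum c (λ j → f j + y *ℕ g j) ≡ weightedSum c f +ℤ + y * weightedSum c g
weightedSum-+* {zero}  c f g y = sym (trans (+ℤ-identityˡ _) (*ℤ-zeroʳ (+ y)))
weightedSum-+* {suc k} c f g y = begin
  c zero * + (f zero + y *ℕ g zero) +ℤ weightedSum (c ∘ suc) (λ j → f (suc j) + y *ℕ g (suc j))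
    ≡⟨ cong₂ (λ u v → c zero * u +ℤ v)
             (trans (pos-+ (f zero) _) (cong (+ f zero +ℤ_) (pos-* y (g zero))))
             (weightedSum-+* (c ∘ suc) (f ∘ suc) (g ∘ suc) y) ⟩
  c zero * (+ f zero +ℤ + y * + g zero) +ℤ (Sf +ℤ + y * Sg)
    ≡⟨ solve 6 (λ c₀ f₀ y g₀ Sf Sg → c₀ :* (f₀ :+ y :* g₀) :+ (Sf :+ y :* Sg)
                                  := (c₀ :* f₀ :+ Sf) :+ y :* (c₀ :* g₀ :+ Sg))
             refl (c zero) (+ f zero) (+ y) (+ g zero) Sf Sg ⟩
  (c zero * + f zero +ℤ Sf) +ℤ + y * (c zero * + g zero +ℤ Sg) ∎
  where
  open ≡-Reasoning
  open +-*-Solver using (solve; _:+_; _:*_; _:=_)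
  Sf = weightedSum (c ∘ suc) (f ∘ suc)
  Sg = weightedSum (c ∘ suc) (g ∘ suc)

weightedSum-dot : ∀ {k} (c : Fin k → ℤ) (Q : Fin k → List ℕ) →
                  (∀ i → weightedSum c (λ j → coeffℕ (Q j) i) ≡ 0ℤ) →
                  ∀ ys → weightedSum c (λ j → dot (Q j) ys) ≡ 0ℤ
weightedSum-dot c Q coeffs≡0 []       = weightedSum-0 c
weightedSum-dot c Q coeffs≡0 (y ∷ ys) = begin
  weightedSum c (λ j → dot (tail₀ (Q j)) ys + y *ℕ head₀ (Q j))
    ≡⟨ weightedSum-+* c (λ j → dot (tail₀ (Q j)) ys) (head₀ ∘ Q) y ⟩
  weightedSum c (λ j → dot (tail₀ (Q j)) ys) +ℤ + y * weightedSum c (head₀ ∘ Q)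
    ≡⟨ cong₂ (λ u v → u +ℤ + y * v) (weightedSum-dot c (tail₀ ∘ Q) (coeffs≡0 ∘ suc) ys) (coeffs≡0 0) ⟩
  0ℤ +ℤ + y * 0ℤ
    ≡⟨ trans (+ℤ-identityˡ _) (*ℤ-zeroʳ (+ y)) ⟩
  0ℤ ∎
  where open ≡-Reasoning

nonneg-resp-≈u : ∀ {σ τ} → σ ≈u τ → All (0ℤ ≤ℤ_) σ ⇔ All (0ℤ ≤ℤ_) τ
nonneg-resp-≈u empty≈zero     = mk⇔ (λ _ → +≤+ z≤n ∷ []) (λ _ → [])
nonneg-resp-≈u (dup a)        = mk⇔ (λ { (p ∷ []) → p ∷ p ∷ [] }) (λ { (p ∷ _) → p ∷ [] })
nonneg-resp-≈u ≈u-refl        = ⇔-refl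
nonneg-resp-≈u (≈u-sym p)     = ⇔-sym (nonneg-resp-≈u p)
nonneg-resp-≈u (≈u-trans p q) = ⇔-trans (nonneg-resp-≈u p) (nonneg-resp-≈u q)
nonneg-resp-≈u (≈u-++ {σ} {σ'} p q) = mk⇔
  (λ h → ++⁺ (to (nonneg-resp-≈u p) (++⁻ˡ σ h)) (to (nonneg-resp-≈u q) (++⁻ʳ σ h)))
  (λ h → ++⁺ (from (nonneg-resp-≈u p) (++⁻ˡ σ' h)) (from (nonneg-resp-≈u q) (++⁻ʳ σ' h)))

natPoly-nonneg : ∀ a as → All (0ℤ ≤ℤ_) (natPoly a as)
natPoly-nonneg a as = map⁺ (universal (λ _ → +≤+ z≤n) (a ∷ as))

coeff-∣∣ : ∀ P → All (0ℤ ≤ℤ_) P → ∀ i → coeff P i ≡ + coeffℕ (map ∣_∣ P) i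
coeff-∣∣ []      _        zero    = refl
coeff-∣∣ []      _        (suc i) = coeff-∣∣ [] [] i
coeff-∣∣ (a ∷ P) (a≥0 ∷ _) zero    = sym (0≤i⇒+∣i∣≡i a≥0)
coeff-∣∣ (a ∷ P) (_ ∷ P≥0) (suc i) = coeff-∣∣ P P≥0 i

≡⇒⇔ : ∀ (A : Subset) {m n} → m ≡ n → A m ⇔ A n
≡⇒⇔ A refl = ⇔-refl

module Idempotent (U : SetSystem) (idempotent : IsIdempotent U) where
  open IsUltrafilter (proj₁ idempotent)

  U-cong : ∀ {A B : Subset} → (∀ n → A n ⇔ B n) → U A ⇔ U B
  U-cong A⇔B = mk⇔ (upward (to ∘ A⇔B)) (upward (from ∘ A⇔B))

  U-const : ∀ {P : Set} → U (λ _ → P) ⇔ P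
  U-const = mk⇔ (proj₂ ∘ inhabited) (λ p → upward (λ _ _ → p) full)

  U-⊕-idem : ∀ A → (U ⊕ U) A ⇔ U A
  U-⊕-idem A = mk⇔ (proj₁ (proj₂ (proj₂ idempotent) A)) (proj₂ (proj₂ (proj₂ idempotent) A))

  U-≥ : ∀ N → U (N ≤_)
  U-≥ zero    = upward (λ _ _ → z≤n) full
  U-≥ (suc N) with ultra (_≡ N)
  ... | inj₁ U∋N = ⊥-elim (proj₁ (proj₂ idempotent) N U∋N)
  ... | inj₂ U∌N = upward (λ y (N≤y , y≢N) → ≤∧≢⇒< N≤y (y≢N ∘ sym)) (inter (U-≥ N) U∌N)

  U-all : ∀ {k} (A : Fin k → Subset) → (∀ j → U (A j)) → U (λ n → ∀ j → A j n)
  U-all {zero}  A _  = upward (λ _ _ ()) full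
  U-all {suc k} A UA = upward (λ { n (a₀ , a) zero → a₀ ; n (a₀ , a) (suc j) → a j })
                              (inter (UA zero) (U-all (A ∘ suc) (UA ∘ suc)))

  ⟦_⟧ : List ℕ → SetSystem
  ⟦ [] ⟧    A = A 0
  ⟦ s ∷ σ ⟧ A = U (λ y → ⟦ σ ⟧ (shift A (y *ℕ s)))

  ⟦⟧-cong : ∀ σ {A B : Subset} → (∀ n → A n ⇔ B n) → ⟦ σ ⟧ A ⇔ ⟦ σ ⟧ B
  ⟦⟧-cong []      A⇔B = A⇔B 0
  ⟦⟧-cong (s ∷ σ) A⇔B = U-cong (λ y → ⟦⟧-cong σ (λ m → A⇔B (m + y *ℕ s)))

  ⟦⟧-++ : ∀ σ τ A → ⟦ σ ++ τ ⟧ A ⇔ ⟦ σ ⟧ (λ n → ⟦ τ ⟧ (shift A n))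
  ⟦⟧-++ []      τ A = ⟦⟧-cong τ (λ m → ≡⇒⇔ A (sym (+-identityʳ m)))
  ⟦⟧-++ (s ∷ σ) τ A = U-cong λ y →
    ⇔-trans (⟦⟧-++ σ τ (shift A (y *ℕ s)))
            (⟦⟧-cong σ (λ n → ⟦⟧-cong τ (λ m → ≡⇒⇔ A (+-assoc m n (y *ℕ s)))))

  ⟦⟧-++-cong : ∀ σ σ' τ τ' → (∀ A → ⟦ σ ⟧ A ⇔ ⟦ σ' ⟧ A) → (∀ A → ⟦ τ ⟧ A ⇔ ⟦ τ' ⟧ A) →
               ∀ A → ⟦ σ ++ τ ⟧ A ⇔ ⟦ σ' ++ τ' ⟧ A
  ⟦⟧-++-cong σ σ' τ τ' σ⇔σ' τ⇔τ' A =
    ⇔-trans (⟦⟧-++ σ τ A)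
      (⇔-trans (σ⇔σ' _)
        (⇔-trans (⟦⟧-cong σ' (λ n → τ⇔τ' (shift A n))) (⇔-sym (⟦⟧-++ σ' τ' A))))

  ⟦[]⟧⇔⟦0⟧ : ∀ A → ⟦ [] ⟧ A ⇔ ⟦ 0 ∷ [] ⟧ A
  ⟦[]⟧⇔⟦0⟧ A = ⇔-trans (⇔-sym U-const) (U-cong (λ y → ≡⇒⇔ A (sym (*-zeroʳ y))))

  ⟦a⟧⇔⟦aa⟧ : ∀ a A → ⟦ a ∷ [] ⟧ A ⇔ ⟦ a ∷ a ∷ [] ⟧ A
  ⟦a⟧⇔⟦aa⟧ a A = ⇔-trans (⇔-sym (U-⊕-idem (λ n → A (n *ℕ a))))
                          (U-cong (λ y → U-cong (λ z → ≡⇒⇔ A (*-distribʳ-+ a z y))))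

  ⟦⟧-resp-≈u : ∀ {σ τ} → σ ≈u τ → ∀ A → ⟦ map ∣_∣ σ ⟧ A ⇔ ⟦ map ∣_∣ τ ⟧ A
  ⟦⟧-resp-≈u empty≈zero     = ⟦[]⟧⇔⟦0⟧
  ⟦⟧-resp-≈u (dup a)        = ⟦a⟧⇔⟦aa⟧ ∣ a ∣
  ⟦⟧-resp-≈u ≈u-refl        A = ⇔-refl
  ⟦⟧-resp-≈u (≈u-sym p)     A = ⇔-sym (⟦⟧-resp-≈u p A)
  ⟦⟧-resp-≈u (≈u-trans p q) A = ⇔-trans (⟦⟧-resp-≈u p A) (⟦⟧-resp-≈u q A)
  ⟦⟧-resp-≈u (≈u-++ {σ} {σ'} {τ} {τ'} p q)
    rewrite map-++ ∣_∣ σ τ | map-++ ∣_∣ σ' τ' =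
      ⟦⟧-++-cong (map ∣_∣ σ) (map ∣_∣ σ') (map ∣_∣ τ) (map ∣_∣ τ') (⟦⟧-resp-≈u p) (⟦⟧-resp-≈u q)

  linComb⇒⟦⟧ : ∀ a as A → linComb a as U A → ⟦ map ∣_∣ (natPoly a as) ⟧ A
  linComb⇒⟦⟧ a []       A A∈ = A∈
  linComb⇒⟦⟧ a (b ∷ bs) A A∈ = upward (λ y → linComb⇒⟦⟧ b bs (shift A (y *ℕ a))) A∈

  ⟦⟧-uncons : ∀ σ {A} → ⟦ σ ⟧ A → U (λ y → ⟦ tail₀ σ ⟧ (shift A (y *ℕ head₀ σ)))
  ⟦⟧-uncons []      {A} = to (⟦[]⟧⇔⟦0⟧ A)
  ⟦⟧-uncons (_ ∷ _)     = λ A∈ → A∈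

  ⟦⟧-[] : ∀ σ {A} → length σ ≤ 0 → ⟦ σ ⟧ A → A 0
  ⟦⟧-[] [] _ A∈ = A∈

  separated-witnesses : ∀ D {k} (b : Fin k → List ℕ) (A : Fin k → Subset) N →
                        (∀ j → length (b j) ≤ D) → (∀ j → ⟦ b j ⟧ (A j)) →
                        ∃ λ ys → (∀ j → A j (dot (b j) ys)) × Separated N b ys
  separated-witnesses zero b A N short A∈ =
    [] , (λ j → ⟦⟧-[] (b j) (short j) (A∈ j)) , (λ i j → inj₁ (≈ᶜ-[] (b i) (b j) (short i) (short j)))
  separated-witnesses (suc D) b A N short A∈
    with inhabited (inter (U-≥ N) (U-all _ (λ j → ⟦⟧-uncons (b j) (A∈ j))))
  ... | y , N≤y , tails∈
    with separated-witnesses D (tail₀ ∘ b) (λ j → shift (A j) (y *ℕ head₀ (b j)))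
                             (N + y *ℕ maxFin (head₀ ∘ b)) (λ j → length-tail₀ (b j) (short j)) tails∈
  ... | ys , ∈A , tails-separated =
    y ∷ ys , ∈A , λ i j → separated-∷ (b i) (b j) y ys N≤y
                            (≤-maxFin (head₀ ∘ b) i) (≤-maxFin (head₀ ∘ b) j) (tails-separated i j)

theorem4p4 : (a₀ : ℕ) (as : List ℕ) (k : ℕ) (c : Fin k → ℤ) (P : Fin k → List ℤ) →
    (∀ j → P j ≈u natPoly a₀ as) → LinRelZero c P →
    (∀ (U : SetSystem) → IsIdempotent U → ∀ (A : Subset) → linComb a₀ as U A →
       ∃ λ (x : Fin k → ℕ) → (∀ j → A (x j)) × sumFin (λ j → c j * + (x j)) ≡ 0ℤ)
    × ((∀ i j → i ≢ j → ¬ (P i ≡Poly P j)) →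
       ∀ (U : SetSystem) → IsIdempotent U → ∀ (A : Subset) → linComb a₀ as U A →
       ∃ λ (x : Fin k → ℕ) → (∀ j → A (x j)) × (∀ i j → i ≢ j → x i ≢ x j)
         × sumFin (λ j → c j * + (x j)) ≡ 0ℤ)
theorem4p4 a₀ as k c P P≈ relation =
    (λ U idem A A∈ → let (ys , ∈A , _ , sum≡0) = solution U idem A A∈ in
       (λ j → dot (Q j) ys) , ∈A , sum≡0)
  , (λ distinct U idem A A∈ → let (ys , ∈A , separated , sum≡0) = solution U idem A A∈ in
       (λ j → dot (Q j) ys) , ∈A , (λ i j i≢j → distinct-values {ys = ys} distinct i≢j (separated i j)) , sum≡0)
  where
  Q : Fin k → List ℕ
  Q j = map ∣_∣ (P j)

  coeff-Q : ∀ j i → coeff (P j) i ≡ + coeffℕ (Q j) i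
  coeff-Q j = coeff-∣∣ (P j) (from (nonneg-resp-≈u (P≈ j)) (natPoly-nonneg a₀ as))

  distinct-values : ∀ {i j ys} → (∀ i j → i ≢ j → ¬ (P i ≡Poly P j)) → i ≢ j →
                    Q i ≈ᶜ Q j ⊎ Apart 1 (dot (Q i) ys) (dot (Q j) ys) → dot (Q i) ys ≢ dot (Q j) ys
  distinct-values {i} {j} distinct i≢j (inj₁ Qi≈Qj) =
    ⊥-elim (distinct i j i≢j (λ n → trans (coeff-Q i n) (trans (cong +_ (Qi≈Qj n)) (sym (coeff-Q j n)))))
  distinct-values _ _ (inj₂ apart) = apart⇒≢ apart

  solution : ∀ U → IsIdempotent U → ∀ A → linComb a₀ as U A →
             ∃ λ ys → (∀ j → A (dot (Q j) ys)) × Separated 1 Q ys × weightedSum c (λ j → dot (Q j) ys) ≡ 0ℤ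
  solution U idem A A∈ =
    let open Idempotent U idem
        (ys , ∈A , separated) = separated-witnesses (maxFin (length ∘ Q)) Q (λ _ → A) 1
                                  (≤-maxFin (length ∘ Q)) (λ j → from (⟦⟧-resp-≈u (P≈ j) A) (linComb⇒⟦⟧ a₀ as A A∈))
    in ys , ∈A , separated
     , weightedSum-dot c Q (λ i → trans (sumFin-cong (λ j → cong (c j *_) (sym (coeff-Q j i)))) (relation i)) ys
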